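{- For $q\ge3$, $0\le a<d$ and $r>0$, $$|\lambda_r^a|\le\max\{A(r,s,a):s\in\mathbb Z,\ \max(a-r+1,0)\le s\le\min(a,d-r)\}.$$
   Context: For a finite classical polar space of rank $d$, order $q$ and type $\epsilon$ ($\epsilon=0,\frac12,1,1,\frac32,2$ for $Q^+(2d-1,q)$, $H(2d-1,q)$, $Q(2d,q)$, $W(2d-1,q)$, $H(2d,q)$, $Q^-(2d+1,q)$), $A_i$ is the adjacency matrix on generators with $(A_i)_{xy}=1$ iff $d-\dim(x\cap y)=i$; they have common eigenspaces $V_0,\dots,V_d$ on which $A_s$ acts as $P_{r,s}=\sum_{t=\max(r-s,0)}^{\min(d-s,r)}(-1)^{r-t}\genfrac{[}{]}{0pt}{}{d-r}{d-s-t}_q\genfrac{[}{]}{0pt}{}{r}{t}_q q^{\binom{r-t}{2}+\binom{s-r+t}{2}+(s-r+t)\epsilon}$, and $\lambda_r^a=\sum_{s=0}^aP_{r,d-s}$. Also $A(r,s,a)=\genfrac{[}{]}{0pt}{}{d-r}{s}_q q^{\binom{d-r-s}{2}+(d-r-s)\epsilon}\genfrac{[}{]}{0pt}{}{r-1}{a-s}_q q^{\binom{r-a+s}{2}}$. Gaussian coefficients are $0$ outside $0\le k\le n$. -}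

module Defs where

open import Data.Nat using (ℕ; zero; suc; _+_; _*_; _∸_; _^_; _≤_; _<_; _⊔_; _⊓_; _≤?_)
open import Data.Nat.Combinatorics using (_C_)
open import Data.Nat.Primality using (Prime)
open import Data.Integer as ℤ using (ℤ; +_)
open import Data.List using (List; map; upTo; foldr)
open import Data.Product using (Σ; _×_)
open import Data.Unit using (⊤)
open import Data.Empty using (⊥)
open import Data.Bool using (if_then_else_)
open import Relation.Nullary.Decidable using (⌊_⌋)
open import Relation.Binary.PropositionalEquality using (_≡_)

-- The six types of finite classical polar spaces of rank d:
--   Qplus : Q⁺(2d-1,q)  ε = 0
--   Hodd  : H(2d-1,q)   ε = 1/2
--   Qpar  : Q(2d,q)     ε = 1
--   W     : W(2d-1,q)   ε = 1
--   Heven : H(2d,q)     ε = 3/2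
--   Qminus: Q⁻(2d+1,q)  ε = 2
data PolarType : Set where
  Qplus Hodd Qpar W Heven Qminus : PolarType

-- Hermitian types (field order q must be a square)
Hermitian : PolarType → Set
Hermitian Hodd  = ⊤
Hermitian Heven = ⊤
Hermitian _     = ⊥

IsPrimePower : ℕ → Set
IsPrimePower q = Σ ℕ λ p → Σ ℕ λ k → Prime p × (q ≡ p ^ suc k)

isqrtGo : ℕ → ℕ → ℕ
isqrtGo q zero    = zero
isqrtGo q (suc n) = if ⌊ suc n * suc n ≤? q ⌋ then suc n else isqrtGo q n

isqrt : ℕ → ℕ
isqrt q = isqrtGo q q

-- q^(k ε)  (for Hermitian types q is a square, and q^(1/2) = isqrt q)
qε : PolarType → ℕ → ℕ → ℕ
qε Qplus  q k = 1
qε Hodd   q k = isqrt q ^ k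
qε Qpar   q k = q ^ k
qε W      q k = q ^ k
qε Heven  q k = isqrt q ^ (3 * k)
qε Qminus q k = q ^ (2 * k)

gauss : ℕ → ℕ → ℕ → ℕ
gauss q n       zero    = 1
gauss q zero    (suc k) = 0
gauss q (suc n) (suc k) = gauss q n k + q ^ suc k * gauss q n (suc k)

b2 : ℕ → ℕ
b2 n = n C 2

range : ℕ → ℕ → List ℕ
range lo hi = map (λ i → lo + i) (upTo (suc hi ∸ lo))

sumZ : ℕ → ℕ → (ℕ → ℤ) → ℤ
sumZ lo hi f = foldr (λ x acc → f x ℤ.+ acc) (+ 0) (range lo hi)

maxN : ℕ → ℕ → (ℕ → ℕ) → ℕ
maxN lo hi f = foldr (λ x acc → f x ⊔ acc) 0 (range lo hi)

sgn : ℕ → ℤ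
sgn zero          = + 1
sgn (suc zero)    = ℤ.- (+ 1)
sgn (suc (suc n)) = sgn n

-- P_{r,s}; on the summation range t ≥ r - s, so all ∸ below are genuine
P : PolarType → ℕ → ℕ → ℕ → ℕ → ℤ
P τ q d r s =
  sumZ (r ∸ s) ((d ∸ s) ⊓ r) λ t →
    sgn (r ∸ t) ℤ.*
    + (gauss q (d ∸ r) (d ∸ s ∸ t) * gauss q r t
       * q ^ (b2 (r ∸ t) + b2 (s + t ∸ r)) * qε τ q (s + t ∸ r))

lam : PolarType → ℕ → ℕ → ℕ → ℕ → ℤ
lam τ q d r a = sumZ 0 a λ s → P τ q d r (d ∸ s)

-- A(r,s,a); used only for a-r+1 ≤ s ≤ min(a,d-r), where all ∸ are genuine
A : PolarType → ℕ → ℕ → ℕ → ℕ → ℕ → ℕ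
A τ q d r s a =
  gauss q (d ∸ r) s * q ^ b2 (d ∸ r ∸ s) * qε τ q (d ∸ r ∸ s)
  * gauss q (r ∸ 1) (a ∸ s) * q ^ b2 (r + s ∸ a)

module Submission where

-- Each P_{r,d-s} is, up to the sign (-1)^(r+s), the convolution Σ_j (-1)^j B_j C_(s-j) with
-- B_j = [d-r, j] q^(binom(d-r-j, 2) + (d-r-j)ε) and C_k = [r, k] q^binom(r-k, 2). The q-Pascal rule
-- [r, k+1] = [r-1, k+1] + q^(r-1-k) [r-1, k] makes the alternating sum over s ≤ a telescope, leaving
-- λ_r^a = ±Σ_s (-1)^s A(r,s,a). These terms vanish outside max(a-r+1, 0) ≤ s ≤ min(a, d-r); inside that
-- window they are positive and, by [n, k+1](q^(k+1) - 1) = [n, k](q^(n-k) - 1), log-concave in s, hence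
-- unimodal. An alternating sum of a unimodal nonnegative sequence lies between -max and max.

open import Defs
open import Data.Nat as ℕ using (ℕ; zero; suc; _≤_; _<_; _+_; _∸_; _*_; _^_; _⊓_; _⊔_; z≤n; s≤s; NonZero; >-nonZero; >-nonZero⁻¹)
open import Data.Nat.Properties
open import Data.Nat.Combinatorics using (nCk+nC[k+1]≡[n+1]C[k+1]; nC1≡n)
open import Data.Nat.Tactic.RingSolver using (solve-∀)
open import Data.Integer as ℤ using (ℤ; +_; -_; _-_; 0ℤ; 1ℤ; ∣_∣; +≤+; -≤-; -[1+_])
  renaming (_+_ to _+ℤ_; _*_ to _*ℤ_; _≤_ to _≤ℤ_)
import Data.Integer.Properties as ℤP
open import Data.Integer.Tactic.RingSolver renaming (solve-∀ to solve-∀ℤ)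
open import Algebra.Properties.CommutativeSemigroup *-commutativeSemigroup using () renaming (interchange to *-interchange)
open import Algebra.Properties.CommutativeSemigroup ℤP.+-commutativeSemigroup using () renaming (interchange to +ℤ-interchange)
open import Data.List using (foldr; applyUpTo)
open import Data.List.Properties using (map-applyUpTo)
open import Data.Product using (Σ; _×_; _,_)
open import Data.Empty using (⊥-elim)
open import Function using (_∘_; id)
open import Relation.Nullary using (Dec; yes; no)
open import Relation.Binary.PropositionalEquality

∸-cancelˡ : ∀ {x y z} → x ≡ y + z → x ∸ y ≡ z
∸-cancelˡ {y = y} {z} refl = m+n∸m≡n y z

m∸[n∸o]≡m+o∸n : ∀ m {n o} → o ≤ n → m ∸ (n ∸ o) ≡ m + o ∸ n
m∸[n∸o]≡m+o∸n m {o = o} o≤n with m≤n⇒∃[o]m+o≡n o≤n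
... | k , refl = begin
  m ∸ (o + k ∸ o)   ≡⟨ cong (m ∸_) (m+n∸m≡n o k) ⟩
  m ∸ k             ≡⟨ sym ([m+n]∸[m+o]≡n∸o o m k) ⟩
  o + m ∸ (o + k)   ≡⟨ cong (_∸ (o + k)) (+-comm o m) ⟩
  m + o ∸ (o + k)   ∎
  where open ≡-Reasoning

m<o∸n⇒n<o∸m : ∀ {m n o} → m < o ∸ n → n < o ∸ m
m<o∸n⇒n<o∸m {m} {n} {o} m<o∸n =
  m+n≤o⇒m≤o∸n (suc n) (subst (_≤ o) (cong suc (+-comm m n)) (m≤o∸n⇒m+n≤o (suc m) n≤o m<o∸n))
  where
  n≤o : n ≤ o
  n≤o = <⇒≤ (m∸n≢0⇒n<m (λ o∸n≡0 → n≮0 (subst (m <_) o∸n≡0 m<o∸n)))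

t<r∸[d∸s]⇒d∸r<s∸t : ∀ {d r s t} → r ≤ d → s ≤ d → t < r ∸ (d ∸ s) → d ∸ r < s ∸ t
t<r∸[d∸s]⇒d∸r<s∸t {d} {r} {s} {t} r≤d s≤d t<lo with m≤n⇒∃[o]m+o≡n s≤d
... | x , refl rewrite m+n∸m≡n s x
  with m≤n⇒∃[o]m+o≡n (<⇒≤ (m∸n≢0⇒n<m {r} {x} (λ r∸x≡0 → n≮0 (subst (t <_) r∸x≡0 t<lo))))
...   | r₁ , refl rewrite m+n∸m≡n x r₁ =
  subst (_< s ∸ t) (sym d∸r≡) (∸-monoʳ-< t<lo r₁≤s)
  where
  d∸r≡ : s + x ∸ (x + r₁) ≡ s ∸ r₁
  d∸r≡ = trans (cong (_∸ (x + r₁)) (+-comm s x)) ([m+n]∸[m+o]≡n∸o x s r₁)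
  r₁≤s : r₁ ≤ s
  r₁≤s = +-cancelˡ-≤ x r₁ s (subst (x + r₁ ≤_) (+-comm s x) r≤d)

foldUpTo : {A : Set} → (A → A → A) → A → ℕ → (ℕ → A) → A
foldUpTo _∙_ ε zero    f = ε
foldUpTo _∙_ ε (suc n) f = f 0 ∙ foldUpTo _∙_ ε n (f ∘ suc)

foldr-applyUpTo : {A : Set} (_∙_ : A → A → A) (ε : A) (f : ℕ → A) (h : ℕ → ℕ) (n : ℕ) →
                  foldr (λ x acc → f x ∙ acc) ε (applyUpTo h n) ≡ foldUpTo _∙_ ε n (f ∘ h)
foldr-applyUpTo _∙_ ε f h zero    = refl
foldr-applyUpTo _∙_ ε f h (suc n) = cong (f (h 0) ∙_) (foldr-applyUpTo _∙_ ε f (h ∘ suc) n)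

foldr-range : {A : Set} (_∙_ : A → A → A) (ε : A) (f : ℕ → A) (lo hi : ℕ) →
              foldr (λ x acc → f x ∙ acc) ε (range lo hi) ≡ foldUpTo _∙_ ε (suc hi ∸ lo) (λ i → f (lo + i))
foldr-range _∙_ ε f lo hi =
  trans (cong (foldr _ ε) (map-applyUpTo id (λ i → lo + i) (suc hi ∸ lo)))
        (foldr-applyUpTo _∙_ ε f (λ i → lo + i) (suc hi ∸ lo))

sumℤ : ℕ → (ℕ → ℤ) → ℤ
sumℤ = foldUpTo _+ℤ_ 0ℤ

maxℕ : ℕ → (ℕ → ℕ) → ℕ
maxℕ = foldUpTo _⊔_ 0

sumZ≡sumℤ : ∀ lo hi f → sumZ lo hi f ≡ sumℤ (suc hi ∸ lo) (λ i → f (lo + i))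
sumZ≡sumℤ lo hi f = foldr-range _+ℤ_ 0ℤ f lo hi

maxN≡maxℕ : ∀ lo hi f → maxN lo hi f ≡ maxℕ (suc hi ∸ lo) (λ i → f (lo + i))
maxN≡maxℕ lo hi f = foldr-range _⊔_ 0 f lo hi

sumℤ-cong : ∀ n {f g : ℕ → ℤ} → (∀ i → i < n → f i ≡ g i) → sumℤ n f ≡ sumℤ n g
sumℤ-cong zero    f≗g = refl
sumℤ-cong (suc n) f≗g = cong₂ _+ℤ_ (f≗g 0 (s≤s z≤n)) (sumℤ-cong n (λ i i<n → f≗g (suc i) (s≤s i<n)))

sumℤ-neg : ∀ n f → sumℤ n (λ i → - f i) ≡ - sumℤ n f
sumℤ-neg zero    f = refl
sumℤ-neg (suc n) f =
  trans (cong (- f 0 +ℤ_) (sumℤ-neg n (f ∘ suc))) (sym (ℤP.neg-distrib-+ (f 0) (sumℤ n (f ∘ suc))))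

sumℤ-*ˡ : ∀ n c f → sumℤ n (λ i → c *ℤ f i) ≡ c *ℤ sumℤ n f
sumℤ-*ˡ zero    c f = sym (ℤP.*-zeroʳ c)
sumℤ-*ˡ (suc n) c f =
  trans (cong (c *ℤ f 0 +ℤ_) (sumℤ-*ˡ n c (f ∘ suc))) (sym (ℤP.*-distribˡ-+ c (f 0) (sumℤ n (f ∘ suc))))

sumℤ-+ : ∀ m n f → sumℤ (m + n) f ≡ sumℤ m f +ℤ sumℤ n (λ i → f (m + i))
sumℤ-+ zero    n f = sym (ℤP.+-identityˡ _)
sumℤ-+ (suc m) n f = trans (cong (f 0 +ℤ_) (sumℤ-+ m n (f ∘ suc))) (sym (ℤP.+-assoc (f 0) _ _))

sumℤ-suc : ∀ n f → sumℤ (suc n) f ≡ sumℤ n f +ℤ f n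
sumℤ-suc n f = begin
  sumℤ (suc n) f                ≡⟨ cong (λ k → sumℤ k f) (+-comm 1 n) ⟩
  sumℤ (n + 1) f                ≡⟨ sumℤ-+ n 1 f ⟩
  sumℤ n f +ℤ (f (n + 0) +ℤ 0ℤ) ≡⟨ cong (sumℤ n f +ℤ_) (trans (ℤP.+-identityʳ _) (cong f (+-identityʳ n))) ⟩
  sumℤ n f +ℤ f n               ∎
  where open ≡-Reasoning

sumℤ-≡0 : ∀ n f → (∀ i → i < n → f i ≡ 0ℤ) → sumℤ n f ≡ 0ℤ
sumℤ-≡0 zero    f f≡0 = refl
sumℤ-≡0 (suc n) f f≡0 =
  cong₂ _+ℤ_ (f≡0 0 (s≤s z≤n)) (sumℤ-≡0 n (f ∘ suc) (λ i i<n → f≡0 (suc i) (s≤s i<n)))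

sumℤ-reverse : ∀ n f → sumℤ n (λ i → f (n ∸ suc i)) ≡ sumℤ n f
sumℤ-reverse zero    f = refl
sumℤ-reverse (suc n) f =
  trans (cong (f n +ℤ_) (sumℤ-reverse n f)) (trans (ℤP.+-comm (f n) (sumℤ n f)) (sym (sumℤ-suc n f)))

sumℤ-support : ∀ n lo hi f → lo ≤ suc hi → suc hi ≤ n →
               (∀ i → i < lo → f i ≡ 0ℤ) → (∀ i → hi < i → i < n → f i ≡ 0ℤ) →
               sumℤ n f ≡ sumℤ (suc hi ∸ lo) (λ i → f (lo + i))
sumℤ-support n lo hi f lo≤1+hi 1+hi≤n below above = begin
  sumℤ n f                                          ≡⟨ cong (λ k → sumℤ k f) (sym n≡) ⟩
  sumℤ (lo + (len + rest)) f                        ≡⟨ sumℤ-+ lo (len + rest) f ⟩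
  sumℤ lo f +ℤ sumℤ (len + rest) (λ i → f (lo + i)) ≡⟨ cong₂ _+ℤ_ (sumℤ-≡0 lo f below) (sumℤ-+ len rest _) ⟩
  0ℤ +ℤ (middle +ℤ sumℤ rest (λ i → f (lo + (len + i))))
      ≡⟨ cong (λ x → 0ℤ +ℤ (middle +ℤ x)) (sumℤ-≡0 rest _ (λ i i<rest → above _ (hi< i) (<n i i<rest))) ⟩
  0ℤ +ℤ (middle +ℤ 0ℤ)                              ≡⟨ trans (ℤP.+-identityˡ _) (ℤP.+-identityʳ _) ⟩
  middle                                            ∎
  where
  open ≡-Reasoning
  len = suc hi ∸ lo
  middle = sumℤ len (λ i → f (lo + i))
  rest = n ∸ suc hi
  lo+len≡ : lo + len ≡ suc hi
  lo+len≡ = m+[n∸m]≡n lo≤1+hi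
  n≡ : lo + (len + rest) ≡ n
  n≡ = trans (sym (+-assoc lo len rest)) (trans (cong (_+ rest) lo+len≡) (m+[n∸m]≡n 1+hi≤n))
  hi< : ∀ i → hi < lo + (len + i)
  hi< i = subst (_≤ lo + (len + i)) lo+len≡ (subst (lo + len ≤_) (+-assoc lo len i) (m≤m+n (lo + len) i))
  <n : ∀ i → i < rest → lo + (len + i) < n
  <n i i<rest = subst (lo + (len + i) <_) n≡ (+-monoʳ-< lo (+-monoʳ-< len i<rest))

sgn-suc : ∀ n → sgn (suc n) ≡ - sgn n
sgn-suc zero          = refl
sgn-suc (suc zero)    = refl
sgn-suc (suc (suc n)) = sgn-suc n

sgn-+ : ∀ m n → sgn (m + n) ≡ sgn m *ℤ sgn n
sgn-+ zero    n = sym (ℤP.*-identityˡ (sgn n))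
sgn-+ (suc m) n = begin
  sgn (suc m + n)        ≡⟨ sgn-suc (m + n) ⟩
  - sgn (m + n)          ≡⟨ cong -_ (sgn-+ m n) ⟩
  - (sgn m *ℤ sgn n)     ≡⟨ ℤP.neg-distribˡ-* (sgn m) (sgn n) ⟩
  - sgn m *ℤ sgn n       ≡⟨ cong (_*ℤ sgn n) (sym (sgn-suc m)) ⟩
  sgn (suc m) *ℤ sgn n   ∎
  where open ≡-Reasoning

sgn*sgn≡1 : ∀ n → sgn n *ℤ sgn n ≡ 1ℤ
sgn*sgn≡1 zero          = refl
sgn*sgn≡1 (suc zero)    = refl
sgn*sgn≡1 (suc (suc n)) = sgn*sgn≡1 n

∣sgn∣≡1 : ∀ n → ∣ sgn n ∣ ≡ 1
∣sgn∣≡1 zero          = refl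
∣sgn∣≡1 (suc zero)    = refl
∣sgn∣≡1 (suc (suc n)) = ∣sgn∣≡1 n

∣sgn*i∣≡∣i∣ : ∀ n i → ∣ sgn n *ℤ i ∣ ≡ ∣ i ∣
∣sgn*i∣≡∣i∣ n i = trans (ℤP.abs-* (sgn n) i) (trans (cong (ℕ._* ∣ i ∣) (∣sgn∣≡1 n)) (*-identityˡ ∣ i ∣))

sgn-cancel : ∀ t r′ J → sgn (t + r′) *ℤ sgn (t + J) *ℤ sgn J ≡ sgn r′
sgn-cancel t r′ J = begin
  sgn (t + r′) *ℤ sgn (t + J) *ℤ sgn J                     ≡⟨ cong₂ (λ x y → x *ℤ y *ℤ sgn J) (sgn-+ t r′) (sgn-+ t J) ⟩
  sgn t *ℤ sgn r′ *ℤ (sgn t *ℤ sgn J) *ℤ sgn J             ≡⟨ regroup (sgn t) (sgn r′) (sgn J) ⟩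
  (sgn t *ℤ sgn t) *ℤ sgn r′ *ℤ (sgn J *ℤ sgn J)           ≡⟨ cong₂ (λ x y → x *ℤ sgn r′ *ℤ y) (sgn*sgn≡1 t) (sgn*sgn≡1 J) ⟩
  1ℤ *ℤ sgn r′ *ℤ 1ℤ                                       ≡⟨ trans (ℤP.*-identityʳ _) (ℤP.*-identityˡ _) ⟩
  sgn r′                                                   ∎
  where
  open ≡-Reasoning
  regroup : ∀ a b c → a *ℤ b *ℤ (a *ℤ c) *ℤ c ≡ (a *ℤ a) *ℤ b *ℤ (c *ℤ c)
  regroup = solve-∀ℤ

i*[j*0]≡0 : ∀ i j → i *ℤ (j *ℤ 0ℤ) ≡ 0ℤ
i*[j*0]≡0 i j = trans (cong (i *ℤ_) (ℤP.*-zeroʳ j)) (ℤP.*-zeroʳ i)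

-- Alternating sums of unimodal sequences

alternatingSum : ℕ → (ℕ → ℕ) → ℤ
alternatingSum n y = sumℤ n (λ i → sgn i *ℤ + y i)

alternatingSum-suc : ∀ n y → alternatingSum (suc n) y ≡ + y 0 - alternatingSum n (y ∘ suc)
alternatingSum-suc n y = cong₂ _+ℤ_ (ℤP.*-identityˡ (+ y 0)) (begin
  sumℤ n (λ i → sgn (suc i) *ℤ + y (suc i))   ≡⟨ sumℤ-cong n (λ i _ → cong (_*ℤ + y (suc i)) (sgn-suc i)) ⟩
  sumℤ n (λ i → - sgn i *ℤ + y (suc i))       ≡⟨ sumℤ-cong n (λ i _ → sym (ℤP.neg-distribˡ-* (sgn i) _)) ⟩
  sumℤ n (λ i → - (sgn i *ℤ + y (suc i)))     ≡⟨ sumℤ-neg n _ ⟩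
  - alternatingSum n (y ∘ suc)                ∎)
  where open ≡-Reasoning

alternatingSum-support : ∀ n lo hi y → lo ≤ suc hi → suc hi ≤ n →
                         (∀ i → i < lo → y i ≡ 0) → (∀ i → hi < i → i < n → y i ≡ 0) →
                         alternatingSum n y ≡ sgn lo *ℤ alternatingSum (suc hi ∸ lo) (λ i → y (lo + i))
alternatingSum-support n lo hi y lo≤1+hi 1+hi≤n below above = begin
  alternatingSum n y                                       ≡⟨ sumℤ-support n lo hi _ lo≤1+hi 1+hi≤n
                                                               (λ i i<lo → vanish (below i i<lo))
                                                               (λ i hi<i i<n → vanish (above i hi<i i<n)) ⟩
  sumℤ len (λ i → sgn (lo + i) *ℤ + y (lo + i))            ≡⟨ sumℤ-cong len (λ i _ → trans (cong (_*ℤ + y (lo + i)) (sgn-+ lo i))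
                                                                                        (ℤP.*-assoc (sgn lo) (sgn i) _)) ⟩
  sumℤ len (λ i → sgn lo *ℤ (sgn i *ℤ + y (lo + i)))       ≡⟨ sumℤ-*ˡ len (sgn lo) (λ i → sgn i *ℤ + y (lo + i)) ⟩
  sgn lo *ℤ alternatingSum len (λ i → y (lo + i))          ∎
  where
  open ≡-Reasoning
  len = suc hi ∸ lo
  vanish : ∀ {i} → y i ≡ 0 → sgn i *ℤ + y i ≡ 0ℤ
  vanish {i} yᵢ≡0 rewrite yᵢ≡0 = ℤP.*-zeroʳ (sgn i)

NonIncreasing : ℕ → (ℕ → ℕ) → Set
NonIncreasing n y = ∀ i → suc i < n → y (suc i) ≤ y i

Unimodal : ℕ → (ℕ → ℕ) → Set
Unimodal n y = ∀ i → suc (suc i) < n → y (suc i) ≤ y i → y (suc (suc i)) ≤ y (suc i)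

unimodal⇒nonIncreasing : ∀ n y → Unimodal n y → (1 < n → y 1 ≤ y 0) → NonIncreasing n y
unimodal⇒nonIncreasing n y unimodal y₁≤y₀ zero    1<n   = y₁≤y₀ 1<n
unimodal⇒nonIncreasing n y unimodal y₁≤y₀ (suc i) i+2<n =
  unimodal i i+2<n (unimodal⇒nonIncreasing n y unimodal y₁≤y₀ i (≤-trans (n≤1+n _) i+2<n))

unimodal-cong : ∀ n {y z} → (∀ i → i < n → y i ≡ z i) → Unimodal n y → Unimodal n z
unimodal-cong n {y} {z} y≗z unimodal i i+2<n z₁≤z₀ =
  subst₂ _≤_ (y≗z _ i+2<n) (y≗z _ i+1<n)
    (unimodal i i+2<n (subst₂ _≤_ (sym (y≗z _ i+1<n)) (sym (y≗z _ i<n)) z₁≤z₀))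
  where
  i+1<n = <-trans (n<1+n (suc i)) i+2<n
  i<n = <-trans (n<1+n i) i+1<n

LogConcave : ℕ → (ℕ → ℕ) → Set
LogConcave n y = ∀ i → suc (suc i) < n → y i * y (suc (suc i)) ≤ y (suc i) * y (suc i)

Positive : ℕ → (ℕ → ℕ) → Set
Positive n y = ∀ i → i < n → 0 < y i

logConcave⇒unimodal : ∀ n y → Positive n y → LogConcave n y → Unimodal n y
logConcave⇒unimodal n y pos logConcave i i+2<n y₁≤y₀ =
  *-cancelˡ-≤ (y i) {{>-nonZero (pos i (<-trans (n<1+n i) (<-trans (n<1+n (suc i)) i+2<n)))}} (begin
    y i * y (suc (suc i))     ≤⟨ logConcave i i+2<n ⟩
    y (suc i) * y (suc i)     ≤⟨ *-monoˡ-≤ (y (suc i)) y₁≤y₀ ⟩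
    y i * y (suc i)           ∎)
  where open ≤-Reasoning

-- If x₁/x₀ = U₀/V₀ and x₂/x₁ = U₁/V₁, then U₁/V₁ ≤ U₀/V₀ means x₀x₂ ≤ x₁².
ratios⇒logConcave : ∀ {x₀ x₁ x₂ U₀ V₀ U₁ V₁} → .{{NonZero V₀}} → .{{NonZero V₁}} →
                    x₁ * V₀ ≡ x₀ * U₀ → x₂ * V₁ ≡ x₁ * U₁ → U₁ * V₀ ≤ U₀ * V₁ → x₀ * x₂ ≤ x₁ * x₁
ratios⇒logConcave {x₀} {x₁} {x₂} {U₀} {V₀} {U₁} {V₁} ratio₀ ratio₁ U₁V₀≤U₀V₁ =
  *-cancelʳ-≤ (x₀ * x₂) (x₁ * x₁) (V₀ * V₁) {{m*n≢0 V₀ V₁}} (begin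
    x₀ * x₂ * (V₀ * V₁)       ≡⟨ *-interchange x₀ x₂ V₀ V₁ ⟩
    x₀ * V₀ * (x₂ * V₁)       ≡⟨ cong (x₀ * V₀ *_) ratio₁ ⟩
    x₀ * V₀ * (x₁ * U₁)       ≡⟨ *-interchange x₀ V₀ x₁ U₁ ⟩
    x₀ * x₁ * (V₀ * U₁)       ≡⟨ cong (x₀ * x₁ *_) (*-comm V₀ U₁) ⟩
    x₀ * x₁ * (U₁ * V₀)       ≤⟨ *-monoʳ-≤ (x₀ * x₁) U₁V₀≤U₀V₁ ⟩
    x₀ * x₁ * (U₀ * V₁)       ≡⟨ *-interchange x₀ x₁ U₀ V₁ ⟩
    x₀ * U₀ * (x₁ * V₁)       ≡⟨ cong (_* (x₁ * V₁)) (sym ratio₀) ⟩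
    x₁ * V₀ * (x₁ * V₁)       ≡⟨ *-interchange x₁ V₀ x₁ V₁ ⟩
    x₁ * x₁ * (V₀ * V₁)       ∎)
  where open ≤-Reasoning

alternatingSum-nonIncreasing : ∀ n y → NonIncreasing (suc n) y →
                               0ℤ ≤ℤ alternatingSum (suc n) y × alternatingSum (suc n) y ≤ℤ + y 0
alternatingSum-nonIncreasing zero y _ rewrite ℤP.+-identityʳ (1ℤ *ℤ + y 0) | ℤP.*-identityˡ (+ y 0) =
  +≤+ z≤n , ℤP.≤-refl
alternatingSum-nonIncreasing (suc n) y nonInc
  rewrite alternatingSum-suc (suc n) y
  with alternatingSum-nonIncreasing n (y ∘ suc) (λ i i<n → nonInc (suc i) (s≤s i<n))
... | 0≤tail , tail≤y₁ =
  ℤP.i≤j⇒0≤j-i (ℤP.≤-trans tail≤y₁ (+≤+ (nonInc 0 (s≤s (s≤s z≤n))))) ,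
  ℤP.i≤j⇒i-k≤j _ {{ℤ.nonNegative 0≤tail}} ℤP.≤-refl

alternatingSum-unimodal : ∀ n y → Unimodal (suc n) y →
                          + y 0 - + maxℕ (suc n) y ≤ℤ alternatingSum (suc n) y × alternatingSum (suc n) y ≤ℤ + maxℕ (suc n) y
alternatingSum-unimodal zero y _ rewrite ℤP.+-identityʳ (1ℤ *ℤ + y 0) | ℤP.*-identityˡ (+ y 0) =
  ℤP.i-j≤i (+ y 0) (+ (y 0 ⊔ 0)) , +≤+ (m≤m⊔n (y 0) 0)
alternatingSum-unimodal (suc n) y unimodal with y 1 ≤? y 0
... | yes y₁≤y₀ =
  let 0≤sum , sum≤y₀ = alternatingSum-nonIncreasing (suc n) y
                         (unimodal⇒nonIncreasing (suc (suc n)) y unimodal (λ _ → y₁≤y₀))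
      y₀≤max = +≤+ (m≤m⊔n (y 0) _)
  in ℤP.≤-trans (ℤP.i≤j⇒i-j≤0 y₀≤max) 0≤sum , ℤP.≤-trans sum≤y₀ y₀≤max
... | no y₁≰y₀ =
  let tail≥ , tail≤ = alternatingSum-unimodal n (y ∘ suc) (λ i i<n → unimodal (suc i) (s≤s i<n))
  in subst (λ s → + y 0 - + max ≤ℤ s) (sym sum≡) (lower tail≤) ,
     subst (_≤ℤ + max) (sym sum≡) (upper tail≥)
  where
  open ℤP.≤-Reasoning
  max = maxℕ (suc (suc n)) y
  max′ = maxℕ (suc n) (y ∘ suc)
  tail = alternatingSum (suc n) (y ∘ suc)
  sum≡ : alternatingSum (suc (suc n)) y ≡ + y 0 - tail
  sum≡ = alternatingSum-suc (suc n) y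
  max′≤max : + max′ ≤ℤ + max
  max′≤max = +≤+ (m≤n⊔m (y 0) max′)
  lower : tail ≤ℤ + max′ → + y 0 - + max ≤ℤ + y 0 - tail
  lower tail≤ = ℤP.+-monoʳ-≤ (+ y 0) (ℤP.neg-mono-≤ (ℤP.≤-trans tail≤ max′≤max))
  upper : + y 1 - + max′ ≤ℤ tail → + y 0 - tail ≤ℤ + max
  upper tail≥ = begin
    + y 0 - tail              ≤⟨ ℤP.+-monoʳ-≤ (+ y 0) (ℤP.neg-mono-≤ tail≥) ⟩
    + y 0 - (+ y 1 - + max′)  ≡⟨ regroup (+ y 0) (+ y 1) (+ max′) ⟩
    (+ y 0 - + y 1) +ℤ + max′ ≤⟨ ℤP.+-monoˡ-≤ (+ max′) (ℤP.i≤j⇒i-j≤0 (+≤+ (≰⇒≥ y₁≰y₀))) ⟩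
    0ℤ +ℤ + max′              ≤⟨ max′≤max ⟩
    + max                     ∎
    where
    regroup : ∀ a b c → a - (b - c) ≡ (a - b) +ℤ c
    regroup = solve-∀ℤ

-m≤i≤m⇒∣i∣≤m : ∀ i m → - + m ≤ℤ i → i ≤ℤ + m → ∣ i ∣ ≤ m
-m≤i≤m⇒∣i∣≤m (+ k)    m       _         (+≤+ k≤m) = k≤m
-m≤i≤m⇒∣i∣≤m -[1+ k ] (suc m) (-≤- k≤m) _         = s≤s k≤m

∣alternatingSum∣≤max : ∀ n y → Unimodal n y → ∣ alternatingSum n y ∣ ≤ maxℕ n y
∣alternatingSum∣≤max zero    y _        = z≤n
∣alternatingSum∣≤max (suc n) y unimodal =
  let lower , upper = alternatingSum-unimodal n y unimodal
  in -m≤i≤m⇒∣i∣≤m _ _ (ℤP.≤-trans (ℤP.i≤j+i (- + maxℕ (suc n) y) (+ y 0)) lower) upper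

b2-suc : ∀ n → b2 (suc n) ≡ n + b2 n
b2-suc n = trans (sym (nCk+nC[k+1]≡[n+1]C[k+1] n 1)) (cong (_+ b2 n) (nC1≡n n))

module _ (q : ℕ) where

  gauss-vanishes : ∀ {n k} → n < k → gauss q n k ≡ 0
  gauss-vanishes {zero}  {suc k} _           = refl
  gauss-vanishes {suc n} {suc k} (s≤s n<k)
    rewrite gauss-vanishes n<k | gauss-vanishes (m<n⇒m<1+n n<k) | *-zeroʳ (q ^ suc k) = refl

  gauss-positive : ∀ {n k} → k ≤ n → 1 ≤ gauss q n k
  gauss-positive {n}     {zero}  _         = ≤-refl
  gauss-positive {suc n} {suc k} (s≤s k≤n) = ≤-trans (gauss-positive k≤n) (m≤m+n (gauss q n k) _)

  gauss-recurrences-agree : ∀ n k →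
    gauss q n (suc k) * q ^ suc k + gauss q n k ≡ gauss q n k * q ^ (n ∸ k) + gauss q n (suc k)
  gauss-recurrences-agree zero    zero    = refl
  gauss-recurrences-agree zero    (suc k) = refl
  gauss-recurrences-agree (suc n) zero = begin
    (1 + q ^ 1 * Y) * q ^ 1 + 1     ≡⟨ regroup q Y ⟩
    q ^ 1 * (Y * q ^ 1 + 1) + 1     ≡⟨ cong (λ x → q ^ 1 * x + 1) (gauss-recurrences-agree n 0) ⟩
    q ^ 1 * (1 * q ^ n + Y) + 1     ≡⟨ expand q (q ^ n) Y ⟩
    1 * q ^ suc n + (1 + q ^ 1 * Y) ∎
    where
    open ≡-Reasoning
    Y = gauss q n 1
    regroup : ∀ q Y → (1 + q * 1 * Y) * (q * 1) + 1 ≡ q * 1 * (Y * (q * 1) + 1) + 1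
    regroup = solve-∀
    expand : ∀ q qⁿ Y → q * 1 * (1 * qⁿ + Y) + 1 ≡ 1 * (q * qⁿ) + (1 + q * 1 * Y)
    expand = solve-∀
  gauss-recurrences-agree (suc n) (suc k) with k <? n
  ... | yes k<n = begin
    (Y + q * p * Z) * (q * p) + (X + p * Y) ≡⟨ regroup X Y Z p q ⟩
    q * p * (Z * (q * p) + Y) + (Y * p + X) ≡⟨ cong₂ (λ u v → q * p * u + v) (gauss-recurrences-agree n (suc k)) IH ⟩
    q * p * (Y * w + Z) + (X * (q * w) + Y) ≡⟨ expand X Y Z p q w ⟩
    (X + p * Y) * (q * w) + (Y + q * p * Z) ≡⟨ cong (λ e → (X + p * Y) * q ^ e + (Y + q * p * Z)) (sym n∸k≡) ⟩
    (X + p * Y) * q ^ (n ∸ k) + (Y + q * p * Z) ∎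
    where
    open ≡-Reasoning
    X = gauss q n k
    Y = gauss q n (suc k)
    Z = gauss q n (suc (suc k))
    p = q ^ suc k
    w = q ^ (n ∸ suc k)
    n∸k≡ : n ∸ k ≡ suc (n ∸ suc k)
    n∸k≡ = +-∸-assoc 1 k<n
    IH : Y * p + X ≡ X * (q * w) + Y
    IH = subst (λ e → Y * p + X ≡ X * q ^ e + Y) n∸k≡ (gauss-recurrences-agree n k)
    regroup : ∀ X Y Z p q → (Y + q * p * Z) * (q * p) + (X + p * Y) ≡ q * p * (Z * (q * p) + Y) + (Y * p + X)
    regroup = solve-∀
    expand : ∀ X Y Z p q w → q * p * (Y * w + Z) + (X * (q * w) + Y) ≡ (X + p * Y) * (q * w) + (Y + q * p * Z)
    expand = solve-∀
  ... | no k≮n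
    rewrite gauss-vanishes {n} {suc k} (s≤s (≮⇒≥ k≮n))
          | gauss-vanishes {n} {suc (suc k)} (s≤s (m≤n⇒m≤1+n (≮⇒≥ k≮n)))
          | m≤n⇒m∸n≡0 (≮⇒≥ k≮n)
    = simplify (gauss q n k) (q ^ suc k) (q ^ suc (suc k))
    where
    simplify : ∀ X p p′ → (0 + p′ * 0) * p′ + (X + p * 0) ≡ (X + p * 0) * 1 + (0 + p′ * 0)
    simplify = solve-∀

  gauss-pascal′ : ∀ n k → gauss q (suc n) (suc k) ≡ gauss q n k * q ^ (n ∸ k) + gauss q n (suc k)
  gauss-pascal′ n k = begin
    gauss q n k + q ^ suc k * gauss q n (suc k) ≡⟨ +-comm (gauss q n k) _ ⟩
    q ^ suc k * gauss q n (suc k) + gauss q n k ≡⟨ cong (_+ gauss q n k) (*-comm (q ^ suc k) _) ⟩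
    gauss q n (suc k) * q ^ suc k + gauss q n k ≡⟨ gauss-recurrences-agree n k ⟩
    gauss q n k * q ^ (n ∸ k) + gauss q n (suc k) ∎
    where open ≡-Reasoning

module _ (q : ℕ) .{{_ : NonZero q}} where

  pow∸1 : ℕ → ℕ
  pow∸1 w = q ^ w ∸ 1

  pow∸1+1 : ∀ w → pow∸1 w + 1 ≡ q ^ w
  pow∸1+1 w = m∸n+n≡m (m^n>0 q w)

  gauss-ratio : ∀ n k → gauss q n (suc k) * pow∸1 (suc k) ≡ gauss q n k * pow∸1 (n ∸ k)
  gauss-ratio n k = +-cancelʳ-≡ (Y + X) _ _ (begin
    Y * pow∸1 (suc k) + (Y + X)   ≡⟨ absorb Y (pow∸1 (suc k)) X ⟩
    Y * (pow∸1 (suc k) + 1) + X   ≡⟨ cong (λ u → Y * u + X) (pow∸1+1 (suc k)) ⟩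
    Y * q ^ suc k + X             ≡⟨ gauss-recurrences-agree q n k ⟩
    X * q ^ (n ∸ k) + Y           ≡⟨ cong (λ u → X * u + Y) (sym (pow∸1+1 (n ∸ k))) ⟩
    X * (pow∸1 (n ∸ k) + 1) + Y   ≡⟨ sym (absorb X (pow∸1 (n ∸ k)) Y) ⟩
    X * pow∸1 (n ∸ k) + (X + Y)   ≡⟨ cong (λ u → X * pow∸1 (n ∸ k) + u) (+-comm X Y) ⟩
    X * pow∸1 (n ∸ k) + (Y + X)   ∎)
    where
    open ≡-Reasoning
    X = gauss q n k
    Y = gauss q n (suc k)
    absorb : ∀ Y E X → Y * E + (Y + X) ≡ Y * (E + 1) + X
    absorb = solve-∀

  pow∸1-monoʳ : ∀ w → pow∸1 w ≤ pow∸1 (suc w)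
  pow∸1-monoʳ w = ∸-monoˡ-≤ 1 (^-monoʳ-≤ q (n≤1+n w))

  q*pow∸1≤pow∸1-suc : ∀ w → q * pow∸1 w ≤ pow∸1 (suc w)
  q*pow∸1≤pow∸1-suc w = +-cancelʳ-≤ 1 _ _ (begin
    q * pow∸1 w + 1   ≤⟨ +-monoʳ-≤ (q * pow∸1 w) (>-nonZero⁻¹ q) ⟩
    q * pow∸1 w + q   ≡⟨ +-comm (q * pow∸1 w) q ⟩
    q + q * pow∸1 w   ≡⟨ sym (*-suc q (pow∸1 w)) ⟩
    q * suc (pow∸1 w) ≡⟨ cong (q *_) (trans (+-comm 1 _) (pow∸1+1 w)) ⟩
    q ^ suc w         ≡⟨ sym (pow∸1+1 (suc w)) ⟩
    pow∸1 (suc w) + 1 ∎)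
    where open ≤-Reasoning

  pow∸1-positive : 2 ≤ q → ∀ w → 1 ≤ pow∸1 (suc w)
  pow∸1-positive 2≤q w = ∸-monoˡ-≤ 1 (begin
    2         ≤⟨ 2≤q ⟩
    q         ≡⟨ sym (*-identityʳ q) ⟩
    q * 1     ≤⟨ *-monoʳ-≤ q (m^n>0 q w) ⟩
    q ^ suc w ∎)
    where open ≤-Reasoning

-- λ_r^a as an alternating sum of the A(r,s,a)

antidiagonal : (ℕ → ℕ → ℤ) → ℕ → ℤ
antidiagonal v s = sumℤ (suc s) (λ j → v j (s ∸ j))

antidiagonal-pascal : ∀ (v v′ : ℕ → ℕ → ℤ) →
                      (∀ j → v′ j 0 ≡ v j 0) → (∀ j k → v′ j (suc k) ≡ v j (suc k) +ℤ v j k) →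
                      ∀ s → antidiagonal v′ (suc s) ≡ antidiagonal v (suc s) +ℤ antidiagonal v s
antidiagonal-pascal v v′ base step zero = begin
  v′ 0 1 +ℤ antidiagonal (v′ ∘ suc) 0             ≡⟨ cong₂ _+ℤ_ (step 0 0) (cong (_+ℤ 0ℤ) (base 1)) ⟩
  (v 0 1 +ℤ v 0 0) +ℤ (v 1 0 +ℤ 0ℤ)               ≡⟨ cong ((v 0 1 +ℤ v 0 0) +ℤ_) (sym (ℤP.+-identityʳ _)) ⟩
  (v 0 1 +ℤ v 0 0) +ℤ ((v 1 0 +ℤ 0ℤ) +ℤ 0ℤ)       ≡⟨ +ℤ-interchange (v 0 1) (v 0 0) (v 1 0 +ℤ 0ℤ) 0ℤ ⟩
  (v 0 1 +ℤ (v 1 0 +ℤ 0ℤ)) +ℤ (v 0 0 +ℤ 0ℤ)       ∎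
  where open ≡-Reasoning
antidiagonal-pascal v v′ base step (suc s) = begin
  v′ 0 (2 + s) +ℤ antidiagonal (v′ ∘ suc) (suc s)
    ≡⟨ cong₂ _+ℤ_ (step 0 (suc s)) (antidiagonal-pascal (v ∘ suc) (v′ ∘ suc) (λ j → base (suc j)) (λ j → step (suc j)) s) ⟩
  (v 0 (2 + s) +ℤ v 0 (1 + s)) +ℤ (antidiagonal (v ∘ suc) (suc s) +ℤ antidiagonal (v ∘ suc) s)
    ≡⟨ +ℤ-interchange (v 0 (2 + s)) (v 0 (1 + s)) _ _ ⟩
  (v 0 (2 + s) +ℤ antidiagonal (v ∘ suc) (suc s)) +ℤ (v 0 (1 + s) +ℤ antidiagonal (v ∘ suc) s) ∎
  where open ≡-Reasoning

alternating-telescope : ∀ (f g : ℕ → ℤ) → f 0 ≡ g 0 → (∀ s → f (suc s) ≡ g (suc s) +ℤ g s) →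
                        ∀ a → sumℤ (suc a) (λ s → sgn s *ℤ f s) ≡ sgn a *ℤ g a
alternating-telescope f g base step zero = trans (ℤP.+-identityʳ _) (cong (1ℤ *ℤ_) base)
alternating-telescope f g base step (suc a) = begin
  sumℤ (suc (suc a)) (λ s → sgn s *ℤ f s)               ≡⟨ sumℤ-suc (suc a) (λ s → sgn s *ℤ f s) ⟩
  sumℤ (suc a) (λ s → sgn s *ℤ f s) +ℤ sgn (suc a) *ℤ f (suc a)
    ≡⟨ cong₂ _+ℤ_ (alternating-telescope f g base step a) (cong₂ _*ℤ_ (sgn-suc a) (step a)) ⟩
  sgn a *ℤ g a +ℤ - sgn a *ℤ (g (suc a) +ℤ g a)          ≡⟨ cancel (sgn a) (g a) (g (suc a)) ⟩
  - sgn a *ℤ g (suc a)                                   ≡⟨ cong (_*ℤ g (suc a)) (sym (sgn-suc a)) ⟩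
  sgn (suc a) *ℤ g (suc a)                               ∎
  where
  open ≡-Reasoning
  cancel : ∀ x u v → x *ℤ u +ℤ - x *ℤ (v +ℤ u) ≡ - x *ℤ v
  cancel = solve-∀ℤ

-- A(r,s,a) = A₁ (d ∸ r) s * A₂ (r ∸ 1) r (a ∸ s), where c ^ k stands for q^(kε).
module _ (q c : ℕ) where

  A₁ : ℕ → ℕ → ℕ
  A₁ n j = gauss q n j * (q ^ b2 (n ∸ j) * c ^ (n ∸ j))

  A₂ : ℕ → ℕ → ℕ → ℕ
  A₂ g r k = gauss q g k * q ^ b2 (r ∸ k)

  A₂-pascal : ∀ m k → A₂ (suc m) (suc m) (suc k) ≡ A₂ m (suc m) (suc k) + A₂ m (suc m) k
  A₂-pascal m k with k ≤? m
  ... | yes k≤m = begin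
    gauss q (suc m) (suc k) * q ^ b2 (m ∸ k)                 ≡⟨ cong (_* q ^ b2 (m ∸ k)) (gauss-pascal′ q m k) ⟩
    (X * q ^ (m ∸ k) + Y) * q ^ b2 (m ∸ k)                   ≡⟨ distribute X Y (q ^ (m ∸ k)) (q ^ b2 (m ∸ k)) ⟩
    Y * q ^ b2 (m ∸ k) + X * (q ^ (m ∸ k) * q ^ b2 (m ∸ k))  ≡⟨ cong (λ e → Y * q ^ b2 (m ∸ k) + X * e) (sym (^-distribˡ-+-* q (m ∸ k) _)) ⟩
    Y * q ^ b2 (m ∸ k) + X * q ^ (m ∸ k + b2 (m ∸ k))        ≡⟨ cong (λ e → Y * q ^ b2 (m ∸ k) + X * q ^ e) (sym (b2-suc (m ∸ k))) ⟩
    Y * q ^ b2 (m ∸ k) + X * q ^ b2 (suc (m ∸ k))            ≡⟨ cong (λ e → Y * q ^ b2 (m ∸ k) + X * q ^ b2 e) (sym (+-∸-assoc 1 k≤m)) ⟩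
    Y * q ^ b2 (m ∸ k) + X * q ^ b2 (suc m ∸ k)              ∎
    where
    open ≡-Reasoning
    X = gauss q m k
    Y = gauss q m (suc k)
    distribute : ∀ X Y p p′ → (X * p + Y) * p′ ≡ Y * p′ + X * (p * p′)
    distribute = solve-∀
  ... | no k≰m
    rewrite gauss-vanishes q {suc m} {suc k} (s≤s (≰⇒> k≰m))
          | gauss-vanishes q {m} {k} (≰⇒> k≰m)
          | gauss-vanishes q {m} {suc k} (m<n⇒m<1+n (≰⇒> k≰m)) = refl

  convolution : ℕ → ℕ → ℕ → ℕ → ℤ
  convolution n g r = antidiagonal (λ j k → sgn j *ℤ + (A₁ n j * A₂ g r k))

  convolution-pascal : ∀ n m s → convolution n (suc m) (suc m) (suc s)
                                 ≡ convolution n m (suc m) (suc s) +ℤ convolution n m (suc m) s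
  convolution-pascal n m =
    antidiagonal-pascal (λ j k → sgn j *ℤ + (A₁ n j * A₂ m (suc m) k))
                        (λ j k → sgn j *ℤ + (A₁ n j * A₂ (suc m) (suc m) k))
                        (λ j → refl) step
    where
    step : ∀ j k → sgn j *ℤ + (A₁ n j * A₂ (suc m) (suc m) (suc k))
                   ≡ sgn j *ℤ + (A₁ n j * A₂ m (suc m) (suc k)) +ℤ sgn j *ℤ + (A₁ n j * A₂ m (suc m) k)
    step j k = begin
      sgn j *ℤ + (A₁ n j * A₂ (suc m) (suc m) (suc k))                  ≡⟨ cong (λ x → sgn j *ℤ + (A₁ n j * x)) (A₂-pascal m k) ⟩
      sgn j *ℤ + (A₁ n j * (A₂ m (suc m) (suc k) + A₂ m (suc m) k))     ≡⟨ cong (λ x → sgn j *ℤ + x) (*-distribˡ-+ (A₁ n j) _ _) ⟩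
      sgn j *ℤ + (A₁ n j * A₂ m (suc m) (suc k) + A₁ n j * A₂ m (suc m) k)
        ≡⟨ cong (sgn j *ℤ_) (ℤP.pos-+ (A₁ n j * A₂ m (suc m) (suc k)) (A₁ n j * A₂ m (suc m) k)) ⟩
      sgn j *ℤ (+ (A₁ n j * A₂ m (suc m) (suc k)) +ℤ + (A₁ n j * A₂ m (suc m) k))
        ≡⟨ ℤP.*-distribˡ-+ (sgn j) _ _ ⟩
      sgn j *ℤ + (A₁ n j * A₂ m (suc m) (suc k)) +ℤ sgn j *ℤ + (A₁ n j * A₂ m (suc m) k) ∎
      where open ≡-Reasoning

  alternating-convolution : ∀ n m a →
    sumℤ (suc a) (λ s → sgn s *ℤ convolution n (suc m) (suc m) s) ≡ sgn a *ℤ convolution n m (suc m) a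
  alternating-convolution n m =
    alternating-telescope (convolution n (suc m) (suc m)) (convolution n m (suc m)) refl (convolution-pascal n m)

P-term : PolarType → ℕ → ℕ → ℕ → ℕ → ℕ → ℤ
P-term τ q d r s t =
  sgn (r ∸ t) *ℤ + (gauss q (d ∸ r) (d ∸ s ∸ t) * gauss q r t
                    * q ^ (b2 (r ∸ t) + b2 (s + t ∸ r)) * qε τ q (s + t ∸ r))

module _ (τ : PolarType) (q c : ℕ) (qε≡c^ : ∀ k → qε τ q k ≡ c ^ k) where

  private
    shuffle₁ : ∀ t r′ J n′ → t + r′ + (J + n′) ≡ t + J + (r′ + n′)
    shuffle₁ = solve-∀
    shuffle₂ : ∀ t r′ J n′ → t + r′ + (J + n′) ≡ r′ + n′ + (t + J)
    shuffle₂ = solve-∀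
    shuffle₃ : ∀ t r′ n′ → r′ + n′ + t ≡ t + r′ + n′
    shuffle₃ = solve-∀

  -- With r = t + r′, s = t + J and d = r + J + n′ every truncated subtraction in P-term is exact.
  P-term-normal-form : ∀ t r′ J n′ →
    P-term τ q (t + r′ + (J + n′)) (t + r′) (t + r′ + (J + n′) ∸ (t + J)) t
    ≡ (sgn (t + r′) *ℤ sgn (t + J)) *ℤ (sgn J *ℤ + (A₁ q c (J + n′) J * A₂ q c (t + r′) (t + r′) t))
  P-term-normal-form t r′ J n′
    rewrite m+n∸m≡n (t + r′) (J + n′)
          | ∸-cancelˡ {t + r′ + (J + n′)} {t + J} {r′ + n′} (shuffle₁ t r′ J n′)
          | ∸-cancelˡ {t + r′ + (J + n′)} {r′ + n′} {t + J} (shuffle₂ t r′ J n′)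
          | ∸-cancelˡ {r′ + n′ + t} {t + r′} {n′} (shuffle₃ t r′ n′)
          | m+n∸m≡n t J
          | m+n∸m≡n t r′
          | m+n∸m≡n J n′
          | qε≡c^ n′
          | ^-distribˡ-+-* q (b2 r′) (b2 n′)
    = begin
      sgn r′ *ℤ + X
        ≡⟨ cong₂ (λ u v → u *ℤ + v) (sym (sgn-cancel t r′ J)) (regroup G₁ G₂ (q ^ b2 r′) (q ^ b2 n′) (c ^ n′)) ⟩
      sgn (t + r′) *ℤ sgn (t + J) *ℤ sgn J *ℤ + Y          ≡⟨ ℤP.*-assoc (sgn (t + r′) *ℤ sgn (t + J)) (sgn J) (+ Y) ⟩
      sgn (t + r′) *ℤ sgn (t + J) *ℤ (sgn J *ℤ + Y)        ∎
    where
    open ≡-Reasoning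
    G₁ = gauss q (J + n′) J
    G₂ = gauss q (t + r′) t
    X = G₁ * G₂ * (q ^ b2 r′ * q ^ b2 n′) * c ^ n′
    Y = G₁ * (q ^ b2 n′ * c ^ n′) * (G₂ * q ^ b2 r′)
    regroup : ∀ g₁ g₂ x y z → g₁ * g₂ * (x * y) * z ≡ g₁ * (y * z) * (g₂ * x)
    regroup = solve-∀

  P-term≡±A₁*A₂ : ∀ {d r s t} → r ≤ d → s ≤ d → t ≤ s →
    P-term τ q d r (d ∸ s) t ≡ (sgn r *ℤ sgn s) *ℤ (sgn (s ∸ t) *ℤ + (A₁ q c (d ∸ r) (s ∸ t) * A₂ q c r r t))
  P-term≡±A₁*A₂ {d} {r} {s} {t} r≤d s≤d t≤s with r <? t
  ... | yes r<t
    rewrite gauss-vanishes q r<t | *-zeroʳ (gauss q (d ∸ r) (d ∸ (d ∸ s) ∸ t)) | *-zeroʳ (A₁ q c (d ∸ r) (s ∸ t))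
    = trans (ℤP.*-zeroʳ (sgn (r ∸ t))) (sym (i*[j*0]≡0 (sgn r *ℤ sgn s) (sgn (s ∸ t))))
  ... | no r≮t with d ∸ r <? s ∸ t
  ...   | yes d∸r<s∸t rewrite m∸[m∸n]≡n s≤d | gauss-vanishes q d∸r<s∸t
    = trans (ℤP.*-zeroʳ (sgn (r ∸ t))) (sym (i*[j*0]≡0 (sgn r *ℤ sgn s) (sgn (s ∸ t))))
  ...   | no d∸r≮s∸t with m≤n⇒∃[o]m+o≡n t≤s | m≤n⇒∃[o]m+o≡n (≮⇒≥ r≮t) | m≤n⇒∃[o]m+o≡n r≤d
  ...     | J , refl | r′ , refl | n₀ , refl
    with m≤n⇒∃[o]m+o≡n (subst₂ (λ x y → y ≤ x) (m+n∸m≡n (t + r′) n₀) (m+n∸m≡n t J) (≮⇒≥ d∸r≮s∸t))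
  ...       | n′ , refl = trans (P-term-normal-form t r′ J n′)
    (cong₂ (λ n J′ → sgn (t + r′) *ℤ sgn (t + J) *ℤ (sgn J′ *ℤ + (A₁ q c n J′ * A₂ q c (t + r′) (t + r′) t)))
           (sym (m+n∸m≡n (t + r′) (J + n′))) (sym (m+n∸m≡n t J)))

  P≡convolution : ∀ {d r s} → r ≤ d → s ≤ d → P τ q d r (d ∸ s) ≡ (sgn r *ℤ sgn s) *ℤ convolution q c (d ∸ r) r r s
  P≡convolution {d} {r} {s} r≤d s≤d = begin
    P τ q d r (d ∸ s)                                    ≡⟨ sumZ≡sumℤ lo hi (P-term τ q d r (d ∸ s)) ⟩
    sumℤ (suc hi ∸ lo) (λ i → P-term τ q d r (d ∸ s) (lo + i))
      ≡⟨ sym (sumℤ-support (suc s) lo hi _ lo≤1+hi (s≤s hi≤s) below-range above-range) ⟩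
    sumℤ (suc s) (P-term τ q d r (d ∸ s))                ≡⟨ sumℤ-cong (suc s) (λ t t≤s → P-term≡±A₁*A₂ r≤d s≤d (≤-pred t≤s)) ⟩
    sumℤ (suc s) (λ t → sgn r *ℤ sgn s *ℤ term (s ∸ t) t) ≡⟨ sumℤ-*ˡ (suc s) (sgn r *ℤ sgn s) (λ t → term (s ∸ t) t) ⟩
    sgn r *ℤ sgn s *ℤ sumℤ (suc s) (λ t → term (s ∸ t) t) ≡⟨ cong (sgn r *ℤ sgn s *ℤ_) reindex ⟩
    sgn r *ℤ sgn s *ℤ convolution q c (d ∸ r) r r s       ∎
    where
    open ≡-Reasoning
    lo = r ∸ (d ∸ s)
    hi = (d ∸ (d ∸ s)) ⊓ r
    term : ℕ → ℕ → ℤ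
    term J t = sgn J *ℤ + (A₁ q c (d ∸ r) J * A₂ q c r r t)
    hi≡ : hi ≡ s ⊓ r
    hi≡ = cong (_⊓ r) (m∸[m∸n]≡n s≤d)
    hi≤s : hi ≤ s
    hi≤s = subst (_≤ s) (sym hi≡) (m⊓n≤m s r)
    lo≤1+hi : lo ≤ suc hi
    lo≤1+hi = m≤n⇒m≤1+n (⊓-glb (∸-monoˡ-≤ (d ∸ s) r≤d) (m∸n≤m r (d ∸ s)))
    below-range : ∀ t → t < lo → P-term τ q d r (d ∸ s) t ≡ 0ℤ
    below-range t t<lo rewrite m∸[m∸n]≡n s≤d | gauss-vanishes q (t<r∸[d∸s]⇒d∸r<s∸t r≤d s≤d t<lo) =
      ℤP.*-zeroʳ (sgn (r ∸ t))
    above-range : ∀ t → hi < t → t < suc s → P-term τ q d r (d ∸ s) t ≡ 0ℤ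
    above-range t hi<t t≤s = trans (P-term≡±A₁*A₂ r≤d s≤d (≤-pred t≤s)) (vanish (r <? t))
      where
      vanish : Dec (r < t) → sgn r *ℤ sgn s *ℤ term (s ∸ t) t ≡ 0ℤ
      vanish (yes r<t) rewrite gauss-vanishes q r<t | *-zeroʳ (A₁ q c (d ∸ r) (s ∸ t)) =
        i*[j*0]≡0 (sgn r *ℤ sgn s) (sgn (s ∸ t))
      vanish (no r≮t) = ⊥-elim (<⇒≱ (subst (_< t) hi≡ hi<t) (⊓-glb (≤-pred t≤s) (≮⇒≥ r≮t)))
    reindex : sumℤ (suc s) (λ t → term (s ∸ t) t) ≡ convolution q c (d ∸ r) r r s
    reindex = trans (sumℤ-cong (suc s) (λ t t≤s → cong (term (s ∸ t)) (sym (m∸[m∸n]≡n (≤-pred t≤s)))))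
                    (sumℤ-reverse (suc s) (λ J → term J (s ∸ J)))

  A≡A₁*A₂ : ∀ d m {a j} → j ≤ a → A τ q d (suc m) j a ≡ A₁ q c (d ∸ suc m) j * A₂ q c m (suc m) (a ∸ j)
  A≡A₁*A₂ d m {a} {j} j≤a
    rewrite qε≡c^ (d ∸ suc m ∸ j) | m∸[n∸o]≡m+o∸n (suc m) j≤a = regroup (gauss q (d ∸ suc m) j) _ _ _ _
    where
    regroup : ∀ g x y g′ z → g * x * y * g′ * z ≡ g * (x * y) * (g′ * z)
    regroup = solve-∀

  convolution≡alternatingSum-A : ∀ d m a →
    convolution q c (d ∸ suc m) m (suc m) a ≡ alternatingSum (suc a) (λ j → A τ q d (suc m) j a)
  convolution≡alternatingSum-A d m a =
    sumℤ-cong (suc a) (λ j j≤a → cong (λ x → sgn j *ℤ + x) (sym (A≡A₁*A₂ d m (≤-pred j≤a))))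

  lam≡±alternatingSum-A : ∀ {d m a} → suc m ≤ d → a < d →
    lam τ q d (suc m) a ≡ sgn (suc m) *ℤ (sgn a *ℤ alternatingSum (suc a) (λ j → A τ q d (suc m) j a))
  lam≡±alternatingSum-A {d} {m} {a} r≤d a<d = begin
    lam τ q d (suc m) a                                            ≡⟨ sumZ≡sumℤ 0 a (λ s → P τ q d (suc m) (d ∸ s)) ⟩
    sumℤ (suc a) (λ s → P τ q d (suc m) (d ∸ s))
      ≡⟨ sumℤ-cong (suc a) (λ s s≤a → P≡convolution r≤d (≤-trans (≤-pred s≤a) (<⇒≤ a<d))) ⟩
    sumℤ (suc a) (λ s → sgn (suc m) *ℤ sgn s *ℤ conv s)
      ≡⟨ sumℤ-cong (suc a) (λ s _ → ℤP.*-assoc (sgn (suc m)) (sgn s) (conv s)) ⟩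
    sumℤ (suc a) (λ s → sgn (suc m) *ℤ (sgn s *ℤ conv s))          ≡⟨ sumℤ-*ˡ (suc a) (sgn (suc m)) (λ s → sgn s *ℤ conv s) ⟩
    sgn (suc m) *ℤ sumℤ (suc a) (λ s → sgn s *ℤ conv s)            ≡⟨ cong (sgn (suc m) *ℤ_) (alternating-convolution q c n m a) ⟩
    sgn (suc m) *ℤ (sgn a *ℤ convolution q c n m (suc m) a)        ≡⟨ cong (λ x → sgn (suc m) *ℤ (sgn a *ℤ x)) (convolution≡alternatingSum-A d m a) ⟩
    sgn (suc m) *ℤ (sgn a *ℤ alternatingSum (suc a) (λ j → A τ q d (suc m) j a)) ∎
    where
    open ≡-Reasoning
    n = d ∸ suc m
    conv = convolution q c n (suc m) (suc m)

-- Log-concavity of s ↦ A(r,s,a)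

module _ (q : ℕ) .{{_ : NonZero q}} (c : ℕ) where

  A₁-ratio : ∀ n s → s < n → A₁ q c n (suc s) * (q ^ (n ∸ suc s) * c * pow∸1 q (suc s)) ≡ A₁ q c n s * pow∸1 q (n ∸ s)
  A₁-ratio n s s<n rewrite +-∸-assoc 1 s<n = begin
    G₁ * (q ^ b2 w * c ^ w) * (q ^ w * c * pow∸1 q (suc s))    ≡⟨ regroup₁ G₁ (q ^ b2 w) (c ^ w) (q ^ w) c (pow∸1 q (suc s)) ⟩
    G₁ * pow∸1 q (suc s) * (q ^ b2 w * c ^ w * q ^ w * c)      ≡⟨ cong (_* (q ^ b2 w * c ^ w * q ^ w * c)) (gauss-ratio q n s) ⟩
    G₀ * pow∸1 q (n ∸ s) * (q ^ b2 w * c ^ w * q ^ w * c)      ≡⟨ cong (λ e → G₀ * pow∸1 q e * (q ^ b2 w * c ^ w * q ^ w * c)) (+-∸-assoc 1 s<n) ⟩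
    G₀ * pow∸1 q (suc w) * (q ^ b2 w * c ^ w * q ^ w * c)      ≡⟨ regroup₂ G₀ (q ^ b2 w) (c ^ w) (q ^ w) c (pow∸1 q (suc w)) ⟩
    G₀ * (q ^ w * q ^ b2 w * (c * c ^ w)) * pow∸1 q (suc w)    ≡⟨ cong (λ e → G₀ * (e * (c * c ^ w)) * pow∸1 q (suc w)) (sym (^-distribˡ-+-* q w (b2 w))) ⟩
    G₀ * (q ^ (w + b2 w) * (c * c ^ w)) * pow∸1 q (suc w)      ≡⟨ cong (λ e → G₀ * (q ^ e * (c * c ^ w)) * pow∸1 q (suc w)) (sym (b2-suc w)) ⟩
    G₀ * (q ^ b2 (suc w) * (c * c ^ w)) * pow∸1 q (suc w)      ∎
    where
    open ≡-Reasoning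
    w = n ∸ suc s
    G₀ = gauss q n s
    G₁ = gauss q n (suc s)
    regroup₁ : ∀ g x y z c e → g * (x * y) * (z * c * e) ≡ g * e * (x * y * z * c)
    regroup₁ = solve-∀
    regroup₂ : ∀ g x y z c e → g * e * (x * y * z * c) ≡ g * (z * x * (c * y)) * e
    regroup₂ = solve-∀

  A₂-ratio : ∀ m k → k ≤ m → A₂ q c m (suc m) k * pow∸1 q (m ∸ k) ≡ A₂ q c m (suc m) (suc k) * (pow∸1 q (suc k) * q ^ (m ∸ k))
  A₂-ratio m k k≤m rewrite +-∸-assoc 1 k≤m = begin
    G₀ * q ^ b2 (suc v) * pow∸1 q v               ≡⟨ cong (λ e → G₀ * q ^ e * pow∸1 q v) (b2-suc v) ⟩
    G₀ * q ^ (v + b2 v) * pow∸1 q v               ≡⟨ cong (λ e → G₀ * e * pow∸1 q v) (^-distribˡ-+-* q v (b2 v)) ⟩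
    G₀ * (q ^ v * q ^ b2 v) * pow∸1 q v           ≡⟨ regroup₁ G₀ (q ^ v) (q ^ b2 v) (pow∸1 q v) ⟩
    G₀ * pow∸1 q v * (q ^ b2 v * q ^ v)           ≡⟨ cong (_* (q ^ b2 v * q ^ v)) (sym (gauss-ratio q m k)) ⟩
    G₁ * pow∸1 q (suc k) * (q ^ b2 v * q ^ v)     ≡⟨ regroup₂ G₁ (pow∸1 q (suc k)) (q ^ b2 v) (q ^ v) ⟩
    G₁ * q ^ b2 v * (pow∸1 q (suc k) * q ^ v)     ∎
    where
    open ≡-Reasoning
    v = m ∸ k
    G₀ = gauss q m k
    G₁ = gauss q m (suc k)
    regroup₁ : ∀ g x y e → g * (x * y) * e ≡ g * e * (y * x)
    regroup₁ = solve-∀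
    regroup₂ : ∀ g e y x → g * e * (y * x) ≡ g * y * (e * x)
    regroup₂ = solve-∀

module _ (q : ℕ) .{{_ : NonZero q}} (c n m a : ℕ) where

  A-term : ℕ → ℕ
  A-term s = A₁ q c n s * A₂ q c m (suc m) (a ∸ s)

  ratio-denominator ratio-numerator : ℕ → ℕ
  ratio-denominator s = q ^ (n ∸ suc s) * c * pow∸1 q (suc s) * pow∸1 q (m ∸ (a ∸ suc s))
  ratio-numerator   s = pow∸1 q (n ∸ s) * (pow∸1 q (a ∸ s) * q ^ (m ∸ (a ∸ suc s)))

  A-term-ratio : ∀ {s} → s < n → s < a → a ≤ m + suc s →
                 A-term (suc s) * ratio-denominator s ≡ A-term s * ratio-numerator s
  A-term-ratio {s} s<n s<a a≤m+s+1 = begin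
    A₁ q c n (suc s) * A₂′ k * (V₁ * pow∸1 q (m ∸ k))
      ≡⟨ *-interchange (A₁ q c n (suc s)) (A₂′ k) V₁ (pow∸1 q (m ∸ k)) ⟩
    A₁ q c n (suc s) * V₁ * (A₂′ k * pow∸1 q (m ∸ k))
      ≡⟨ cong₂ _*_ (A₁-ratio q c n s s<n) (A₂-ratio q c m k k≤m) ⟩
    A₁ q c n s * pow∸1 q (n ∸ s) * (A₂′ (suc k) * (pow∸1 q (suc k) * q ^ (m ∸ k)))
      ≡⟨ *-interchange (A₁ q c n s) (pow∸1 q (n ∸ s)) (A₂′ (suc k)) _ ⟩
    A₁ q c n s * A₂′ (suc k) * (pow∸1 q (n ∸ s) * (pow∸1 q (suc k) * q ^ (m ∸ k)))
      ≡⟨ cong (λ e → A₁ q c n s * A₂′ e * (pow∸1 q (n ∸ s) * (pow∸1 q e * q ^ (m ∸ k)))) (sym a∸s≡) ⟩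
    A-term s * ratio-numerator s ∎
    where
    open ≡-Reasoning
    A₂′ = A₂ q c m (suc m)
    k = a ∸ suc s
    V₁ = q ^ (n ∸ suc s) * c * pow∸1 q (suc s)
    a∸s≡ : a ∸ s ≡ suc k
    a∸s≡ = +-∸-assoc 1 s<a
    k≤m : k ≤ m
    k≤m = m≤n+o⇒m∸n≤o a (suc s) (subst (a ≤_) (+-comm m (suc s)) a≤m+s+1)

  private
    ratio-decreasing-normal-form : ∀ w k v s →
      pow∸1 q (suc w) * (pow∸1 q (suc k) * q ^ suc v) * (q ^ suc w * c * pow∸1 q (suc s) * pow∸1 q v)
      ≤ pow∸1 q (suc (suc w)) * (pow∸1 q (suc (suc k)) * q ^ v) * (q ^ w * c * pow∸1 q (suc (suc s)) * pow∸1 q (suc v))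
    ratio-decreasing-normal-form w k v s = begin
      pow∸1 q (suc w) * (pow∸1 q (suc k) * q ^ suc v) * (q ^ suc w * c * pow∸1 q (suc s) * pow∸1 q v)
        ≡⟨ regroup₁ (pow∸1 q (suc w)) (pow∸1 q (suc k)) q (q ^ v) (q ^ w) c (pow∸1 q (suc s)) (pow∸1 q v) ⟩
      q * pow∸1 q (suc w) * pow∸1 q (suc k) * (q * pow∸1 q v) * pow∸1 q (suc s) * (q ^ v * q ^ w * c)
        ≤⟨ *-monoˡ-≤ (q ^ v * q ^ w * c) (*-mono-≤ (*-mono-≤ (*-mono-≤ (q*pow∸1≤pow∸1-suc q (suc w)) (pow∸1-monoʳ q (suc k)))
                                                             (q*pow∸1≤pow∸1-suc q v))
                                                   (pow∸1-monoʳ q (suc s))) ⟩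
      pow∸1 q (suc (suc w)) * pow∸1 q (suc (suc k)) * pow∸1 q (suc v) * pow∸1 q (suc (suc s)) * (q ^ v * q ^ w * c)
        ≡⟨ regroup₂ (pow∸1 q (suc (suc w))) (pow∸1 q (suc (suc k))) (q ^ v) (q ^ w) c (pow∸1 q (suc (suc s))) (pow∸1 q (suc v)) ⟩
      pow∸1 q (suc (suc w)) * (pow∸1 q (suc (suc k)) * q ^ v) * (q ^ w * c * pow∸1 q (suc (suc s)) * pow∸1 q (suc v)) ∎
      where
      open ≤-Reasoning
      regroup₁ : ∀ E₁ Eₖ q qᵛ qʷ c Eₛ Eᵥ → E₁ * (Eₖ * (q * qᵛ)) * (q * qʷ * c * Eₛ * Eᵥ)
                                         ≡ q * E₁ * Eₖ * (q * Eᵥ) * Eₛ * (qᵛ * qʷ * c)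
      regroup₁ = solve-∀
      regroup₂ : ∀ E₂ Eₖ qᵛ qʷ c Eₛ Eᵥ → E₂ * Eₖ * Eᵥ * Eₛ * (qᵛ * qʷ * c)
                                        ≡ E₂ * (Eₖ * qᵛ) * (qʷ * c * Eₛ * Eᵥ)
      regroup₂ = solve-∀

  ratio-decreasing : ∀ {s} → suc (suc s) ≤ n → suc (suc s) ≤ a → a ≤ m + s →
    ratio-numerator (suc s) * ratio-denominator s ≤ ratio-numerator s * ratio-denominator (suc s)
  ratio-decreasing {s} s+2≤n s+2≤a a≤m+s = normalise k<m
    where
    a∸s≡ : a ∸ s ≡ suc (suc (a ∸ suc (suc s)))
    a∸s≡ = trans (+-∸-assoc 1 (<⇒≤ s+2≤a)) (cong suc (+-∸-assoc 1 s+2≤a))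
    k<m : suc (a ∸ suc (suc s)) ≤ m
    k<m = ≤-trans (n≤1+n _) (subst (_≤ m) a∸s≡ (m≤n+o⇒m∸n≤o a s (subst (a ≤_) (+-comm m s) a≤m+s)))
    normalise : suc (a ∸ suc (suc s)) ≤ m →
      ratio-numerator (suc s) * ratio-denominator s ≤ ratio-numerator s * ratio-denominator (suc s)
    normalise k<m
      rewrite +-∸-assoc 1 (<⇒≤ s+2≤n) | +-∸-assoc 1 s+2≤n
            | +-∸-assoc 1 (<⇒≤ s+2≤a) | +-∸-assoc 1 s+2≤a
            | +-∸-assoc 1 k<m
      = ratio-decreasing-normal-form (n ∸ suc (suc s)) (a ∸ suc (suc s)) (m ∸ suc (a ∸ suc (suc s))) s

  module _ (2≤q : 2 ≤ q) (1≤c : 1 ≤ c) where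

    ratio-denominator-positive : ∀ {s} → suc (a ∸ suc s) ≤ m → 0 < ratio-denominator s
    ratio-denominator-positive {s} a∸s≤m rewrite +-∸-assoc 1 a∸s≤m =
      *-mono-≤ (*-mono-≤ (*-mono-≤ (m^n>0 q (n ∸ suc s)) 1≤c) (pow∸1-positive q 2≤q s))
               (pow∸1-positive q 2≤q (m ∸ suc (a ∸ suc s)))

    A-term-positive : ∀ {s} → s ≤ n → a ∸ s ≤ m → 0 < A-term s
    A-term-positive {s} s≤n a∸s≤m =
      *-mono-≤ (*-mono-≤ (gauss-positive q s≤n) (*-mono-≤ (m^n>0 q (b2 (n ∸ s))) (m^n>0 c {{>-nonZero 1≤c}} (n ∸ s))))
               (*-mono-≤ (gauss-positive q a∸s≤m) (m^n>0 q (b2 (suc m ∸ (a ∸ s)))))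

    A-term-logConcave : ∀ {s} → suc (suc s) ≤ n → suc (suc s) ≤ a → a ≤ m + s →
                        A-term s * A-term (suc (suc s)) ≤ A-term (suc s) * A-term (suc s)
    A-term-logConcave {s} s+2≤n s+2≤a a≤m+s =
      ratios⇒logConcave {A-term s} {A-term (suc s)} {A-term (suc (suc s))}
                        {ratio-numerator s} {ratio-denominator s} {ratio-numerator (suc s)} {ratio-denominator (suc s)}
                        {{>-nonZero (ratio-denominator-positive a∸[s+1]<m)}}
                        {{>-nonZero (ratio-denominator-positive a∸[s+2]<m)}}
                        (A-term-ratio s<n s<a (≤-trans a≤m+s (+-monoʳ-≤ m (n≤1+n s))))
                        (A-term-ratio s+2≤n s+2≤a (≤-trans a≤m+s (+-monoʳ-≤ m (m≤n+m s 2))))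
                        (ratio-decreasing s+2≤n s+2≤a a≤m+s)
      where
      s<n : s < n
      s<n = ≤-trans (n≤1+n (suc s)) s+2≤n
      s<a : s < a
      s<a = ≤-trans (n≤1+n (suc s)) s+2≤a
      a∸[s+1]<m : suc (a ∸ suc s) ≤ m
      a∸[s+1]<m = subst (_≤ m) (+-∸-assoc 1 s<a) (m≤n+o⇒m∸n≤o a s (subst (a ≤_) (+-comm m s) a≤m+s))
      a∸[s+2]<m : suc (a ∸ suc (suc s)) ≤ m
      a∸[s+2]<m = subst (_≤ m) (+-∸-assoc 1 s+2≤a) (≤-trans (n≤1+n _) a∸[s+1]<m)

isqrtGo-positive : ∀ q k → 1 ≤ q → 1 ≤ isqrtGo q (suc k)
isqrtGo-positive q k 1≤q with suc k * suc k ≤? q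
... | yes _ = s≤s z≤n
isqrtGo-positive q zero    1≤q | no 1≰q = ⊥-elim (1≰q 1≤q)
isqrtGo-positive q (suc k) 1≤q | no _   = isqrtGo-positive q k 1≤q

qε-power : ∀ τ q → 1 ≤ q → Σ ℕ λ c → 1 ≤ c × (∀ k → qε τ q k ≡ c ^ k)
qε-power Qplus  q       1≤q = 1 , ≤-refl , λ k → sym (^-zeroˡ k)
qε-power Hodd   (suc q) 1≤q = isqrt (suc q) , isqrtGo-positive (suc q) q 1≤q , λ k → refl
qε-power Qpar   q       1≤q = q , 1≤q , λ k → refl
qε-power W      q       1≤q = q , 1≤q , λ k → refl
qε-power Heven  (suc q) 1≤q =
  isqrt (suc q) ^ 3 , m^n>0 _ {{>-nonZero (isqrtGo-positive (suc q) q 1≤q)}} 3 , λ k → sym (^-*-assoc _ 3 k)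
qε-power Qminus q       1≤q = q ^ 2 , m^n>0 q {{>-nonZero 1≤q}} 2 , λ k → sym (^-*-assoc q 2 k)

module _ (τ : PolarType) (q : ℕ) .{{_ : NonZero q}} (2≤q : 2 ≤ q) (c : ℕ) (1≤c : 1 ≤ c)
         (qε≡c^ : ∀ k → qε τ q k ≡ c ^ k) {d m a : ℕ} (a<d : a < d) (r≤d : suc m ≤ d) where

  private
    n lo hi len : ℕ
    n = d ∸ suc m
    lo = a + 1 ∸ suc m
    hi = a ⊓ n
    len = suc hi ∸ lo
    y : ℕ → ℕ
    y s = A τ q d (suc m) s a

  lo≡a∸m : lo ≡ a ∸ m
  lo≡a∸m = cong (_∸ suc m) (+-comm a 1)

  lo≤hi : lo ≤ hi
  lo≤hi = ⊓-glb (subst (_≤ a) (sym lo≡a∸m) (m∸n≤m a m)) (∸-monoˡ-≤ (suc m) (subst (_≤ d) (+-comm 1 a) a<d))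

  A-vanishes-below : ∀ j → j < lo → y j ≡ 0
  A-vanishes-below j j<lo
    rewrite gauss-vanishes q {m} {a ∸ j} (m<o∸n⇒n<o∸m (subst (j <_) lo≡a∸m j<lo))
          | *-zeroʳ (gauss q n j * q ^ b2 (n ∸ j) * qε τ q (n ∸ j)) = refl

  A-vanishes-above : ∀ j → hi < j → j < suc a → y j ≡ 0
  A-vanishes-above j hi<j j≤a
    rewrite gauss-vanishes q {n} {j} (≰⇒> (λ j≤n → <⇒≱ hi<j (⊓-glb (≤-pred j≤a) j≤n))) = refl

  in-window : ∀ {i} → i < len → lo + i ≤ hi
  in-window {i} i<len = ≤-pred (subst (λ x → suc x ≤ suc hi) (+-comm i lo) (m≤o∸n⇒m+n≤o (suc i) (m≤n⇒m≤1+n lo≤hi) i<len))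

  lo≤s⇒a≤m+s : ∀ {s} → lo ≤ s → a ≤ m + s
  lo≤s⇒a≤m+s {s} lo≤s = ≤-trans (m≤n+m∸n a m) (+-monoʳ-≤ m (subst (_≤ s) lo≡a∸m lo≤s))

  window : ℕ → ℕ
  window i = A-term q c n m a (lo + i)

  window-positive : Positive len window
  window-positive i i<len =
    A-term-positive q c n m a 2≤q 1≤c (≤-trans (in-window i<len) (m⊓n≤n a n))
                    (m≤n+o⇒m∸n≤o a (lo + i) (subst (a ≤_) (+-comm m (lo + i)) (lo≤s⇒a≤m+s (m≤m+n lo i))))

  window-logConcave : LogConcave len window
  window-logConcave i i+2<len rewrite +-suc lo (suc i) | +-suc lo i =
    A-term-logConcave q c n m a 2≤q 1≤c (≤-trans s+2≤hi (m⊓n≤n a n)) (≤-trans s+2≤hi (m⊓n≤m a n)) (lo≤s⇒a≤m+s (m≤m+n lo i))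
    where
    s+2≤hi : suc (suc (lo + i)) ≤ hi
    s+2≤hi = subst (_≤ hi) (trans (+-suc lo (suc i)) (cong suc (+-suc lo i))) (in-window i+2<len)

  window-unimodal : Unimodal len (λ i → y (lo + i))
  window-unimodal =
    unimodal-cong len (λ i i<len → sym (A≡A₁*A₂ τ q c qε≡c^ d m (≤-trans (in-window i<len) (m⊓n≤m a n))))
      (logConcave⇒unimodal len window window-positive window-logConcave)

  ∣lam∣≤maxN : ∣ lam τ q d (suc m) a ∣ ≤ maxN lo hi y
  ∣lam∣≤maxN = begin
    ∣ lam τ q d (suc m) a ∣                                    ≡⟨ cong ∣_∣ (lam≡±alternatingSum-A τ q c qε≡c^ r≤d a<d) ⟩
    ∣ sgn (suc m) *ℤ (sgn a *ℤ alternatingSum (suc a) y) ∣     ≡⟨ trans (∣sgn*i∣≡∣i∣ (suc m) _) (∣sgn*i∣≡∣i∣ a _) ⟩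
    ∣ alternatingSum (suc a) y ∣
      ≡⟨ cong ∣_∣ (alternatingSum-support (suc a) lo hi y (m≤n⇒m≤1+n lo≤hi) (s≤s (m⊓n≤m a n)) A-vanishes-below A-vanishes-above) ⟩
    ∣ sgn lo *ℤ alternatingSum len (λ i → y (lo + i)) ∣        ≡⟨ ∣sgn*i∣≡∣i∣ lo _ ⟩
    ∣ alternatingSum len (λ i → y (lo + i)) ∣                  ≤⟨ ∣alternatingSum∣≤max len _ window-unimodal ⟩
    maxℕ len (λ i → y (lo + i))                                ≡⟨ sym (maxN≡maxℕ lo hi y) ⟩
    maxN lo hi y                                               ∎
    where open ≤-Reasoning

corollary8p6 : (τ : PolarType) (q d r a : ℕ)
    → IsPrimePower q → (Hermitian τ → Σ ℕ λ t → t * t ≡ q)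
    → 3 ≤ q → a < d → 0 < r → r ≤ d
    → ∣ lam τ q d r a ∣ ≤ maxN (a + 1 ∸ r) (a ⊓ (d ∸ r)) (λ s → A τ q d r s a)
corollary8p6 τ q d (suc m) a _ _ 3≤q a<d _ r≤d =
  let c , 1≤c , qε≡c^ = qε-power τ q 1≤q
  in ∣lam∣≤maxN τ q {{>-nonZero 1≤q}} (≤-trans (n≤1+n 2) 3≤q) c 1≤c qε≡c^ a<d r≤d
  where
  1≤q : 1 ≤ q
  1≤q = ≤-trans (s≤s z≤n) 3≤q
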